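{- Let $G$ be a cubic $3$-edge-connected graph that has a set of six perfect matchings such that every edge of $G$ is contained in exactly two of them. Then $f(G)\leq 5$.
   Context: Graphs are finite and undirected; parallel edges are allowed. A graph is cubic if every vertex has degree $3$; it is $k$-edge-connected if at least $k$ edges leave every nonempty proper vertex subset. An orientation of $G$ replaces each edge $uv$ by exactly one of the arcs $uv$ or $vu$; for an edge $e$, $\vec e$ denotes the corresponding arc. A digraph is strongly connected if for every nonempty proper vertex subset $X$ some arc leaves $X$. For a $3$-edge-connected graph $G$, the Frank number $f(G)$ is the minimum integer $k$ such that there exist $k$ orientations $D_1,\dots,D_k$ of $G$ with the property that for every edge $e$ of $G$ there is an $i$ with $D_i-\vec e$ strongly connected. -}

module Defs where

open import Data.Nat using (ℕ; zero; suc; _+_; _≤_)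
open import Data.Fin using (Fin; _≟_) renaming (zero to fzero; suc to fsuc)
open import Data.Bool using (Bool; true; false; if_then_else_; _∧_; not; _xor_)
open import Data.Product using (_×_; _,_; proj₁; proj₂; Σ; ∃; ∃-syntax)
open import Relation.Nullary.Decidable using (⌊_⌋)
open import Relation.Binary.PropositionalEquality using (_≡_; _≢_)
open import Function.Definitions using (Injective)

sumF : ∀ {m} → (Fin m → ℕ) → ℕ
sumF {zero}  f = 0
sumF {suc m} f = f fzero + sumF (λ i → f (fsuc i))

countF : ∀ {m} → (Fin m → Bool) → ℕ
countF p = sumF (λ i → if p i then 1 else 0)

-- A finite multigraph (parallel edges allowed; loops are representable,
-- a loop being counted twice in degrees): vertices Fin n, edges Fin m,
-- each edge has an (arbitrarily ordered) pair of endpoints.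
record Graph : Set where
  field
    n    : ℕ
    m    : ℕ
    ends : Fin m → Fin n × Fin n

open Graph public

Vertex : Graph → Set
Vertex G = Fin (n G)

Edge : Graph → Set
Edge G = Fin (m G)

incid : (G : Graph) → Edge G → Vertex G → ℕ
incid G e v = (if ⌊ proj₁ (ends G e) ≟ v ⌋ then 1 else 0)
            + (if ⌊ proj₂ (ends G e) ≟ v ⌋ then 1 else 0)

degIn : (G : Graph) → (Edge G → Bool) → Vertex G → ℕ
degIn G S v = sumF (λ e → if S e then incid G e v else 0)

degree : (G : Graph) → Vertex G → ℕ
degree G v = degIn G (λ _ → true) v

Cubic : Graph → Set
Cubic G = ∀ v → degree G v ≡ 3

VSet : Graph → Set
VSet G = Vertex G → Bool

NonemptyProper : (G : Graph) → VSet G → Set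
NonemptyProper G X = (∃[ v ] X v ≡ true) × (∃[ w ] X w ≡ false)

crosses : (G : Graph) → VSet G → Edge G → Bool
crosses G X e = X (proj₁ (ends G e)) xor X (proj₂ (ends G e))

EdgeConnected : ℕ → Graph → Set
EdgeConnected k G = ∀ (X : VSet G) → NonemptyProper G X → k ≤ countF (crosses G X)

PerfectMatching : (G : Graph) → (Edge G → Bool) → Set
PerfectMatching G M = ∀ v → degIn G M v ≡ 1

Orientation : Graph → Set
Orientation G = Edge G → Bool

tail head : (G : Graph) → Orientation G → Edge G → Vertex G
tail G D e = if D e then proj₁ (ends G e) else proj₂ (ends G e)
head G D e = if D e then proj₂ (ends G e) else proj₁ (ends G e)

StronglyConnectedWithout : (G : Graph) → Orientation G → Edge G → Set
StronglyConnectedWithout G D e =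
  ∀ (X : VSet G) → NonemptyProper G X →
    ∃[ a ] (a ≢ e × X (tail G D a) ≡ true × X (head G D a) ≡ false)

FrankFamily : (G : Graph) → (k : ℕ) → (Fin k → Orientation G) → Set
FrankFamily G k D = ∀ (e : Edge G) → ∃[ i ] StronglyConnectedWithout G (D i) e

-- f(G) ≤ b  (f(G) is the minimum k admitting such a family)
FrankNumberAtMost : Graph → ℕ → Set
FrankNumberAtMost G b = ∃[ k ] (k ≤ b × ∃[ D ] FrankFamily G k D)

{-# OPTIONS --safe #-}
module Submission where

-- Deleting the matching M k (k = 2, …, 5) from the cubic graph leaves a 2-factor; orienting its
-- circuits gives an integer flow φ k which is ±1 off M k and 0 on M k.  An edge lies in only two
-- of the six matchings, so at least two of the four φ k are nonzero on it.  For the fixed 5 × 4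
-- matrix `coefficient`, the five flows f j = Σ k coefficient j k · φ k are then nowhere zero and
-- every edge e has f j e = ±1 for some j; both facts depend only on the local pattern of the φ k
-- at e and are checked by evaluation.  Orient G along the sign of f j.  If f j e = ±1 and no arc
-- other than e left some cut X, the at least two other edges crossing X would all enter it, so the
-- net flow out of X would be at most 1 − 2 < 0, although a flow has net flow 0 across every cut.

open import Defs
open import Data.Bool as Bool using (Bool; true; false; if_then_else_; not; _xor_)
open import Data.Bool.Properties using (if-float)
open import Data.Empty using (⊥-elim)
open import Data.Fin using (Fin; zero; suc; _≟_)
open import Data.Fin.Properties using (all?; any?)
open import Data.Fin.Subset using (Subset)
open import Data.Fin.Subset.Properties using (anySubset?)
open import Data.Integer using (ℤ)
import Data.Integer.Properties as ℤₚ
open import Data.Integer.Tactic.RingSolver using (solve-∀)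
open import Data.List using (List; []; _∷_; _++_; length; tabulate)
open import Data.List.Properties using (length-++-sucʳ)
open import Data.List.Relation.Binary.Pointwise using (Pointwise; []; _∷_; ++⁺)
open import Data.Nat as ℕ using (ℕ; zero; suc; s≤s; z≤n)
import Data.Nat.Properties as ℕₚ
open import Data.Product using (_×_; _,_; proj₁; proj₂; swap; ∃-syntax)
open import Data.Sum using (_⊎_; inj₁; inj₂)
open import Data.Unit using (tt)
open import Data.Vec using (Vec; []; _∷_; lookup) renaming (tabulate to tabulateᵥ)
open import Function.Definitions using (Injective)
open import Level using (0ℓ)
open import Relation.Binary.Definitions using (tri<; tri≈; tri>)
open import Relation.Binary.PropositionalEquality
open import Relation.Nullary using (¬_; Dec; yes; no)
open import Relation.Nullary.Decidable
  using (does; isYes≗does; ¬?; _×-dec_; _⊎-dec_; _→-dec_; from-yes; decidable-stable)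
open import Relation.Unary using (Pred; Decidable)

-- Degrees and balanced orientations

module _ where
  open import Data.Nat using (_+_; _*_; _≤_; _≤?_)
  open import Data.Nat.Properties using (+-suc; +-identityʳ; +-comm; +-monoʳ-≤; ≤-antisym; even≢odd; <-cmp; suc-injective;
                 m≤n⇒m≤1+n; m+n≡0⇒m≡0; m+n≡0⇒n≡0; ≰⇒≥; +-commutativeSemigroup)
  open import Algebra.Properties.CommutativeSemigroup +-commutativeSemigroup using (x∙yz≈y∙xz; interchange)

  δ : ∀ {n} → Fin n → Fin n → ℕ
  δ x y = if does (x ≟ y) then 1 else 0

  δ≤1 : ∀ {n} (x y : Fin n) → δ x y ≤ 1
  δ≤1 x y with does (x ≟ y)
  ... | true  = s≤s z≤n
  ... | false = z≤n

  sumF-cong : ∀ {k} {f g : Fin k → ℕ} → (∀ i → f i ≡ g i) → sumF f ≡ sumF g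
  sumF-cong {zero}  f≡g = refl
  sumF-cong {suc k} f≡g = cong₂ _+_ (f≡g zero) (sumF-cong (λ i → f≡g (suc i)))

  sumF-+ : ∀ {k} (f g : Fin k → ℕ) → sumF (λ i → f i + g i) ≡ sumF f + sumF g
  sumF-+ {zero}  f g = refl
  sumF-+ {suc k} f g = trans (cong (f zero + g zero +_) (sumF-+ (λ i → f (suc i)) (λ i → g (suc i))))
                             (interchange (f zero) (g zero) (sumF (λ i → f (suc i))) (sumF (λ i → g (suc i))))

  sumF-*ˡ : ∀ {k} c (f : Fin k → ℕ) → sumF (λ i → c * f i) ≡ c * sumF f
  sumF-*ˡ {zero}  c f = sym (ℕₚ.*-zeroʳ c)
  sumF-*ˡ {suc k} c f = trans (cong (c * f zero +_) (sumF-*ˡ c (λ i → f (suc i))))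
                              (sym (ℕₚ.*-distribˡ-+ c (f zero) (sumF (λ i → f (suc i)))))

  AlmostEqual : ℕ → ℕ → Set
  AlmostEqual a b = a ≤ suc b × b ≤ suc a

  AlmostEqual-sym : ∀ {a b} → AlmostEqual a b → AlmostEqual b a
  AlmostEqual-sym = swap

  AlmostEqual-+ : ∀ c {a b} → AlmostEqual a b → AlmostEqual (c + a) (c + b)
  AlmostEqual-+ c (a≤1+b , b≤1+a) = shift a≤1+b , shift b≤1+a
    where
    shift : ∀ {x y} → x ≤ suc y → c + x ≤ suc (c + y)
    shift {x} {y} x≤1+y = subst (c + x ≤_) (+-suc c y) (+-monoʳ-≤ c x≤1+y)

  AlmostEqual-even⇒≡ : ∀ {a b} t → AlmostEqual a b → a + b ≡ 2 * t → a ≡ b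
  AlmostEqual-even⇒≡ {a} {b} t (a≤1+b , b≤1+a) even with <-cmp a b
  ... | tri≈ _ a≡b _ = a≡b
  ... | tri< a<b _ _ = ⊥-elim (even≢odd t a (sym (begin
    suc (2 * a)  ≡⟨ cong (λ x → suc (a + x)) (+-identityʳ a) ⟩
    suc (a + a)  ≡⟨ +-suc a a ⟨
    a + suc a    ≡⟨ cong (a +_) (≤-antisym b≤1+a a<b) ⟨
    a + b        ≡⟨ even ⟩
    2 * t        ∎)))
    where open ≡-Reasoning
  ... | tri> _ _ b<a = ⊥-elim (even≢odd t b (sym (begin
    suc (2 * b)  ≡⟨ cong (λ x → suc (b + x)) (+-identityʳ b) ⟩
    suc b + b    ≡⟨ cong (_+ b) (≤-antisym a≤1+b b<a) ⟨
    a + b        ≡⟨ even ⟩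
    2 * t        ∎)))
    where open ≡-Reasoning

  Pointwise-++⁻ : ∀ {A B : Set} {R : A → B → Set} as {bs ds} → Pointwise R (as ++ bs) ds →
    ∃[ cs ] ∃[ es ] (ds ≡ cs ++ es × Pointwise R as cs × Pointwise R bs es)
  Pointwise-++⁻ []       r       = [] , _ , refl , [] , r
  Pointwise-++⁻ (a ∷ as) (x ∷ r) with Pointwise-++⁻ as r
  ... | cs , es , refl , rs , r′ = _ ∷ cs , es , refl , x ∷ rs , r′

  module _ {n : ℕ} where

    Arc : Set
    Arc = Fin n × Fin n

    _⇝_ : Arc → Arc → Set
    p ⇝ d = d ≡ p ⊎ d ≡ swap p

    ⇝-swap : ∀ {p d} → p ⇝ d → p ⇝ swap d
    ⇝-swap (inj₁ refl) = inj₂ refl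
    ⇝-swap (inj₂ refl) = inj₁ refl

    degreeBy : (Arc → Fin n) → List Arc → Fin n → ℕ
    degreeBy end []       w = 0
    degreeBy end (d ∷ ds) w = δ (end d) w + degreeBy end ds w

    outdeg indeg : List Arc → Fin n → ℕ
    outdeg = degreeBy proj₁
    indeg  = degreeBy proj₂

    Balanced : List Arc → Set
    Balanced ds = ∀ w → AlmostEqual (outdeg ds w) (indeg ds w)

    degreeBy-++-∷ : ∀ end pre b post w →
      degreeBy end (pre ++ b ∷ post) w ≡ δ (end b) w + degreeBy end (pre ++ post) w
    degreeBy-++-∷ end []        b post w = refl
    degreeBy-++-∷ end (a ∷ pre) b post w =
      trans (cong (δ (end a) w +_) (degreeBy-++-∷ end pre b post w))
            (x∙yz≈y∙xz (δ (end a) w) (δ (end b) w) (degreeBy end (pre ++ post) w))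

    degree-preserved : ∀ {ps ds} → Pointwise _⇝_ ps ds → ∀ w →
      outdeg ds w + indeg ds w ≡ outdeg ps w + indeg ps w
    degree-preserved []                          w = refl
    degree-preserved {p ∷ ps} {d ∷ ds} (p⇝d ∷ r) w = begin
      (δ (proj₁ d) w + outdeg ds w) + (δ (proj₂ d) w + indeg ds w)  ≡⟨ interchange (δ (proj₁ d) w) _ (δ (proj₂ d) w) _ ⟩
      (δ (proj₁ d) w + δ (proj₂ d) w) + (outdeg ds w + indeg ds w)  ≡⟨ cong₂ _+_ (endpoints p⇝d) (degree-preserved r w) ⟩
      (δ (proj₁ p) w + δ (proj₂ p) w) + (outdeg ps w + indeg ps w)  ≡⟨ interchange (δ (proj₁ p) w) _ (outdeg ps w) _ ⟩
      (δ (proj₁ p) w + outdeg ps w) + (δ (proj₂ p) w + indeg ps w)  ∎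
      where
      open ≡-Reasoning
      endpoints : p ⇝ d → δ (proj₁ d) w + δ (proj₂ d) w ≡ δ (proj₁ p) w + δ (proj₂ p) w
      endpoints (inj₁ refl) = refl
      endpoints (inj₂ refl) = +-comm (δ (proj₂ p) w) _

    degrees-tabulate : ∀ {k} (g : Fin k → Arc) w →
      outdeg (tabulate g) w + indeg (tabulate g) w ≡ sumF (λ a → δ (proj₁ (g a)) w + δ (proj₂ (g a)) w)
    degrees-tabulate {zero}  g w = refl
    degrees-tabulate {suc k} g w =
      trans (interchange (δ (proj₁ (g zero)) w) (outdeg (tabulate (λ a → g (suc a))) w) (δ (proj₂ (g zero)) w) _)
            (cong (δ (proj₁ (g zero)) w + δ (proj₂ (g zero)) w +_) (degrees-tabulate (λ a → g (suc a)) w))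

    arcAt : ∀ u ds →
      (∃[ pre ] ∃[ b ] ∃[ post ] ∃[ z ] (ds ≡ pre ++ b ∷ post × b ⇝ (u , z)))
      ⊎ (outdeg ds u ≡ 0 × indeg ds u ≡ 0)
    arcAt u []             = inj₂ (refl , refl)
    arcAt u ((x , y) ∷ ds) with x ≟ u | y ≟ u
    ... | yes refl | _        = inj₁ ([] , _ , ds , y , refl , inj₁ refl)
    ... | no _     | yes refl = inj₁ ([] , _ , ds , x , refl , inj₂ refl)
    ... | no _     | no _ with arcAt u ds
    ...   | inj₁ (pre , b , post , z , refl , b⇝uz) = inj₁ ((x , y) ∷ pre , b , post , z , refl , b⇝uz)
    ...   | inj₂ isolated                           = inj₂ isolated

    -- The arc on vz is subdivided at u; this raises both degrees at u by one.
    balanced-merge : ∀ {u v z b d₀} dpre dpost → b ⇝ (u , z) → (v , z) ⇝ d₀ → Balanced (d₀ ∷ dpre ++ dpost) →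
      ∃[ d ] ∃[ d′ ] ((u , v) ⇝ d × b ⇝ d′ × Balanced (d ∷ dpre ++ d′ ∷ dpost))
    balanced-merge {u} {v} {z} dpre dpost b⇝uz (inj₁ refl) bal =
      (v , u) , (u , z) , inj₂ refl , b⇝uz , λ w → subst₂ AlmostEqual
        (sym (trans (cong (δ v w +_) (degreeBy-++-∷ proj₁ dpre (u , z) dpost w))
                    (x∙yz≈y∙xz (δ v w) (δ u w) (outdeg (dpre ++ dpost) w))))
        (sym (cong (δ u w +_) (degreeBy-++-∷ proj₂ dpre (u , z) dpost w)))
        (AlmostEqual-+ (δ u w) (bal w))
    balanced-merge {u} {v} {z} dpre dpost b⇝uz (inj₂ refl) bal =
      (u , v) , (z , u) , inj₁ refl , ⇝-swap b⇝uz , λ w → subst₂ AlmostEqual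
        (sym (cong (δ u w +_) (degreeBy-++-∷ proj₁ dpre (z , u) dpost w)))
        (sym (trans (cong (δ v w +_) (degreeBy-++-∷ proj₂ dpre (z , u) dpost w))
                    (x∙yz≈y∙xz (δ v w) (δ u w) (indeg (dpre ++ dpost) w))))
        (AlmostEqual-+ (δ u w) (bal w))

    AlmostEqual-addArc : ∀ {u v} (o i : Fin n → ℕ) → (∀ w → AlmostEqual (o w) (i w)) →
      o u ≡ 0 → i u ≡ 0 → o v ≤ i v → ∀ w → AlmostEqual (δ v w + o w) (δ u w + i w)
    AlmostEqual-addArc {u} {v} o i bal ou≡0 iu≡0 ov≤iv w with u ≟ w
    ... | yes refl rewrite ou≡0 | iu≡0 | +-identityʳ (δ v u) = m≤n⇒m≤1+n (δ≤1 v u) , s≤s z≤n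
    ... | no _ with v ≟ w
    ...   | yes refl = s≤s ov≤iv , m≤n⇒m≤1+n (proj₂ (bal v))
    ...   | no _     = bal w

    balanced-∷-isolated : ∀ {u v ds} → Balanced ds → outdeg ds u ≡ 0 → indeg ds u ≡ 0 →
      ∃[ d ] ((u , v) ⇝ d × Balanced (d ∷ ds))
    balanced-∷-isolated {u} {v} {ds} bal out≡0 in≡0 with outdeg ds v ≤? indeg ds v
    ... | yes out≤in = (v , u) , inj₂ refl , AlmostEqual-addArc (outdeg ds) (indeg ds) bal out≡0 in≡0 out≤in
    ... | no out≰in  = (u , v) , inj₁ refl , λ w → AlmostEqual-sym
      (AlmostEqual-addArc (indeg ds) (outdeg ds) (λ w → AlmostEqual-sym (bal w)) in≡0 out≡0 (≰⇒≥ out≰in) w)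

    -- An arc uv is merged with another arc at u into an arc vz; if there is none, u is isolated in the rest.
    balancedOrientation : ∀ ps → ∃[ ds ] (Pointwise _⇝_ ps ds × Balanced ds)
    balancedOrientation ps = orient (length ps) ps refl
      where
      orient : ∀ k ps → length ps ≡ k → ∃[ ds ] (Pointwise _⇝_ ps ds × Balanced ds)
      orient zero    []               _   = [] , [] , λ _ → z≤n , z≤n
      orient (suc k) ((u , v) ∷ rest) len with arcAt u rest
      ... | inj₁ (pre , b , post , z , refl , b⇝uz)
        with orient k ((v , z) ∷ pre ++ post) (trans (sym (length-++-sucʳ pre b post)) (suc-injective len))
      ...   | d₀ ∷ _ , vz⇝d₀ ∷ r , bal with Pointwise-++⁻ pre r
      ...     | dpre , dpost , refl , rpre , rpost with balanced-merge dpre dpost b⇝uz vz⇝d₀ bal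
      ...       | d , d′ , uv⇝d , b⇝d′ , bal′ = d ∷ dpre ++ d′ ∷ dpost , uv⇝d ∷ ++⁺ rpre (b⇝d′ ∷ rpost) , bal′
      orient (suc k) ((u , v) ∷ rest) len | inj₂ (out≡0 , in≡0) with orient k rest (suc-injective len)
      ... | ds , r , bal with balanced-∷-isolated {ds = ds} bal (m+n≡0⇒m≡0 _ isolated) (m+n≡0⇒n≡0 _ isolated)
        where isolated = trans (degree-preserved r u) (cong₂ _+_ out≡0 in≡0)
      ...   | d , uv⇝d , bal′ = d ∷ ds , uv⇝d ∷ r , bal′

-- Integer flows

open import Data.Integer using (+_; +0; +[1+_]; -[1+_]; 0ℤ; 1ℤ; -1ℤ; -≤-; _+_; _-_; _*_; -_; _≤_)
open import Algebra.Properties.Semiring.Sum ℤₚ.+-*-semiring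
  using (sum; sum-syntax; ∑-comm; *-distribˡ-sum; *-distribʳ-sum; sum-cong-≗; sum-replicate-zero)

χ : Bool → ℤ
χ true  = 1ℤ
χ false = 0ℤ

±1 : Bool → ℤ
±1 true  = 1ℤ
±1 false = -1ℤ

positive : ℤ → Bool
positive +[1+ _ ] = true
positive _        = false

IsUnit : ℤ → Set
IsUnit x = x ≡ 1ℤ ⊎ x ≡ -1ℤ

∑-zero : ∀ {n} {f : Fin n → ℤ} → (∀ i → f i ≡ 0ℤ) → sum f ≡ 0ℤ
∑-zero {n} f≡0 = trans (sum-cong-≗ f≡0) (sum-replicate-zero n)

∑-δ : ∀ {n} (x : Fin n) (g : Fin n → ℤ) → ∑[ y < n ] (+ δ x y * g y) ≡ g x
∑-δ {suc n} zero g = begin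
  1ℤ * g zero + ∑[ y < n ] (0ℤ * g (suc y))
    ≡⟨ cong₂ _+_ (ℤₚ.*-identityˡ (g zero)) (∑-zero {f = λ y → 0ℤ * g (suc y)} (λ y → ℤₚ.*-zeroˡ (g (suc y)))) ⟩
  g zero + 0ℤ  ≡⟨ ℤₚ.+-identityʳ (g zero) ⟩
  g zero       ∎
  where open ≡-Reasoning
∑-δ {suc n} (suc x) g = begin
  0ℤ * g zero + ∑[ y < n ] (+ δ x y * g (suc y))  ≡⟨ cong (_+ ∑[ y < n ] (+ δ x y * g (suc y))) (ℤₚ.*-zeroˡ (g zero)) ⟩
  0ℤ + ∑[ y < n ] (+ δ x y * g (suc y))           ≡⟨ ℤₚ.+-identityˡ _ ⟩
  ∑[ y < n ] (+ δ x y * g (suc y))                ≡⟨ ∑-δ x (λ y → g (suc y)) ⟩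
  g (suc x)                                       ∎
  where open ≡-Reasoning

∑-distrib-− : ∀ {n} (f g : Fin n → ℤ) → ∑[ i < n ] (f i - g i) ≡ sum f - sum g
∑-distrib-− {zero}  f g = refl
∑-distrib-− {suc n} f g =
  trans (cong (_+_ (f zero - g zero)) (∑-distrib-− (λ i → f (suc i)) (λ i → g (suc i))))
        (regroup (f zero) (g zero) _ _)
  where
  regroup : ∀ a b c d → (a - b) + (c - d) ≡ (a + c) - (b + d)
  regroup = solve-∀

∑-mono-≤ : ∀ {n} {f g : Fin n → ℤ} → (∀ i → f i ≤ g i) → sum f ≤ sum g
∑-mono-≤ {zero}  f≤g = ℤₚ.≤-refl
∑-mono-≤ {suc n} f≤g = ℤₚ.+-mono-≤ (f≤g zero) (∑-mono-≤ (λ i → f≤g (suc i)))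

+-countF : ∀ {n} (p : Fin n → Bool) → + countF p ≡ ∑[ i < n ] χ (p i)
+-countF {zero}  p = refl
+-countF {suc n} p =
  trans (ℤₚ.pos-+ (if p zero then 1 else 0) _) (cong₂ _+_ (χ-if (p zero)) (+-countF (λ i → p (suc i))))
  where
  χ-if : ∀ b → + (if b then 1 else 0) ≡ χ b
  χ-if true  = refl
  χ-if false = refl

∂ : ∀ {n} → Arc {n} → Fin n → ℤ
∂ (x , y) v = + δ x v - + δ y v

∑-∂ : ∀ {n} (d : Arc) (g : Fin n → ℤ) → ∑[ v < n ] (∂ d v * g v) ≡ g (proj₁ d) - g (proj₂ d)
∑-∂ {n} (x , y) g = begin
  ∑[ v < n ] (∂ (x , y) v * g v)                           ≡⟨ sum-cong-≗ (λ v → distrib (+ δ x v) (+ δ y v) (g v)) ⟩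
  ∑[ v < n ] (+ δ x v * g v - + δ y v * g v)               ≡⟨ ∑-distrib-− (λ v → + δ x v * g v) (λ v → + δ y v * g v) ⟩
  ∑[ v < n ] (+ δ x v * g v) - ∑[ v < n ] (+ δ y v * g v)  ≡⟨ cong₂ _-_ (∑-δ x g) (∑-δ y g) ⟩
  g x - g y                                                ∎
  where
  open ≡-Reasoning
  distrib : ∀ a b c → (a - b) * c ≡ a * c - b * c
  distrib = solve-∀

orientationOf : ∀ {n k} {g : Fin k → Arc {n}} {ds} → Pointwise _⇝_ (tabulate g) ds → Fin k → Bool
orientationOf (inj₁ _ ∷ _) zero    = true
orientationOf (inj₂ _ ∷ _) zero    = false
orientationOf (_ ∷ r)      (suc a) = orientationOf r a

∑-orientationOf : ∀ {n k} {g : Fin k → Arc {n}} {ds} (r : Pointwise _⇝_ (tabulate g) ds) w →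
  ∑[ a < k ] (±1 (orientationOf r a) * ∂ (g a) w) ≡ + outdeg ds w - + indeg ds w
∑-orientationOf {k = zero}  []                           w = refl
∑-orientationOf {k = suc k} {g} {_ ∷ ds} (inj₁ refl ∷ r) w = begin
  1ℤ * (+ δ x w - + δ y w) + ∑[ a < k ] (±1 (orientationOf r a) * ∂ (g (suc a)) w)
    ≡⟨ cong (_+_ (1ℤ * (+ δ x w - + δ y w))) (∑-orientationOf r w) ⟩
  1ℤ * (+ δ x w - + δ y w) + (+ outdeg ds w - + indeg ds w)
    ≡⟨ regroup (+ δ x w) (+ δ y w) (+ outdeg ds w) (+ indeg ds w) ⟩
  (+ δ x w + + outdeg ds w) - (+ δ y w + + indeg ds w)
    ≡⟨ cong₂ _-_ (ℤₚ.pos-+ (δ x w) (outdeg ds w)) (ℤₚ.pos-+ (δ y w) (indeg ds w)) ⟨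
  + (δ x w ℕ.+ outdeg ds w) - + (δ y w ℕ.+ indeg ds w)
    ∎
  where
  open ≡-Reasoning
  x = proj₁ (g zero)
  y = proj₂ (g zero)
  regroup : ∀ a b c d → 1ℤ * (a - b) + (c - d) ≡ (a + c) - (b + d)
  regroup = solve-∀
∑-orientationOf {k = suc k} {g} {_ ∷ ds} (inj₂ refl ∷ r) w = begin
  -1ℤ * (+ δ x w - + δ y w) + ∑[ a < k ] (±1 (orientationOf r a) * ∂ (g (suc a)) w)
    ≡⟨ cong (_+_ (-1ℤ * (+ δ x w - + δ y w))) (∑-orientationOf r w) ⟩
  -1ℤ * (+ δ x w - + δ y w) + (+ outdeg ds w - + indeg ds w)
    ≡⟨ regroup (+ δ x w) (+ δ y w) (+ outdeg ds w) (+ indeg ds w) ⟩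
  (+ δ y w + + outdeg ds w) - (+ δ x w + + indeg ds w)
    ≡⟨ cong₂ _-_ (ℤₚ.pos-+ (δ y w) (outdeg ds w)) (ℤₚ.pos-+ (δ x w) (indeg ds w)) ⟨
  + (δ y w ℕ.+ outdeg ds w) - + (δ x w ℕ.+ indeg ds w)
    ∎
  where
  open ≡-Reasoning
  x = proj₁ (g zero)
  y = proj₂ (g zero)
  regroup : ∀ a b c d → -1ℤ * (a - b) + (c - d) ≡ (b + c) - (a + d)
  regroup = solve-∀

unit-cut-bound : ∀ {x} → IsUnit x → ∀ b₁ b₂ → x * (χ b₁ - χ b₂) ≤ + 2 - χ (b₁ xor b₂)
unit-cut-bound (inj₁ refl) true  true  = ℤₚ.≤ᵇ⇒≤ tt
unit-cut-bound (inj₁ refl) true  false = ℤₚ.≤ᵇ⇒≤ tt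
unit-cut-bound (inj₁ refl) false true  = ℤₚ.≤ᵇ⇒≤ tt
unit-cut-bound (inj₁ refl) false false = ℤₚ.≤ᵇ⇒≤ tt
unit-cut-bound (inj₂ refl) true  true  = ℤₚ.≤ᵇ⇒≤ tt
unit-cut-bound (inj₂ refl) true  false = ℤₚ.≤ᵇ⇒≤ tt
unit-cut-bound (inj₂ refl) false true  = ℤₚ.≤ᵇ⇒≤ tt
unit-cut-bound (inj₂ refl) false false = ℤₚ.≤ᵇ⇒≤ tt

entering-cut-bound : ∀ x → x ≢ 0ℤ → ∀ b₁ b₂ →
  ¬ ((if positive x then b₁ else b₂) ≡ true × (if positive x then b₂ else b₁) ≡ false) →
  x * (χ b₁ - χ b₂) ≤ - χ (b₁ xor b₂)
entering-cut-bound +0       x≢0 _     _     _      = ⊥-elim (x≢0 refl)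
entering-cut-bound x        _   true  true  _      = ℤₚ.≤-reflexive (ℤₚ.*-zeroʳ x)
entering-cut-bound x        _   false false _      = ℤₚ.≤-reflexive (ℤₚ.*-zeroʳ x)
entering-cut-bound +[1+ n ] _   true  false leaves = ⊥-elim (leaves (refl , refl))
entering-cut-bound +[1+ n ] _   false true  _      =
  ℤₚ.≤-trans (ℤₚ.≤-reflexive (trans (ℤₚ.*-comm +[1+ n ] -1ℤ) (ℤₚ.-1*i≡-i +[1+ n ]))) (-≤- z≤n)
entering-cut-bound -[1+ n ] _   true  false _      = ℤₚ.≤-trans (ℤₚ.≤-reflexive (ℤₚ.*-identityʳ -[1+ n ])) (-≤- z≤n)
entering-cut-bound -[1+ n ] _   false true  leaves = ⊥-elim (leaves (refl , refl))

module _ (G : Graph) where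

  p₁ p₂ : Edge G → Vertex G
  p₁ a = proj₁ (ends G a)
  p₂ a = proj₂ (ends G a)

  IsFlow : (Edge G → ℤ) → Set
  IsFlow f = ∀ v → ∑[ a < m G ] (f a * ∂ (ends G a) v) ≡ 0ℤ

  χ-cut : VSet G → Edge G → ℤ
  χ-cut X a = χ (X (p₁ a)) - χ (X (p₂ a))

  flow-across-cut : ∀ {f} → IsFlow f → ∀ X → ∑[ a < m G ] (f a * χ-cut X a) ≡ 0ℤ
  flow-across-cut {f} flow X = begin
    ∑[ a < m G ] (f a * χ-cut X a)
      ≡⟨ sum-cong-≗ (λ a → cong (f a *_) (sym (∑-∂ (ends G a) (λ v → χ (X v))))) ⟩
    ∑[ a < m G ] (f a * ∑[ v < n G ] (∂ (ends G a) v * χ (X v)))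
      ≡⟨ sum-cong-≗ (λ a → *-distribˡ-sum (f a) (λ v → ∂ (ends G a) v * χ (X v))) ⟩
    ∑[ a < m G ] ∑[ v < n G ] (f a * (∂ (ends G a) v * χ (X v)))
      ≡⟨ ∑-comm (λ a v → f a * (∂ (ends G a) v * χ (X v))) ⟩
    ∑[ v < n G ] ∑[ a < m G ] (f a * (∂ (ends G a) v * χ (X v)))
      ≡⟨ sum-cong-≗ (λ v → sum-cong-≗ (λ a → ℤₚ.*-assoc (f a) (∂ (ends G a) v) (χ (X v)))) ⟨
    ∑[ v < n G ] ∑[ a < m G ] (f a * ∂ (ends G a) v * χ (X v))
      ≡⟨ sum-cong-≗ (λ v → *-distribʳ-sum (χ (X v)) (λ a → f a * ∂ (ends G a) v)) ⟨
    ∑[ v < n G ] (∑[ a < m G ] (f a * ∂ (ends G a) v) * χ (X v))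
      ≡⟨ ∑-zero (λ v → trans (cong (_* χ (X v)) (flow v)) (ℤₚ.*-zeroˡ (χ (X v)))) ⟩
    0ℤ
      ∎
    where open ≡-Reasoning

  ∑-flow : ∀ {r} (c : Fin r → ℤ) (φ : Fin r → Edge G → ℤ) → (∀ k → IsFlow (φ k)) →
    IsFlow (λ a → ∑[ k < r ] (c k * φ k a))
  ∑-flow {r} c φ flows v = begin
    ∑[ a < m G ] (∑[ k < r ] (c k * φ k a) * ∂ (ends G a) v)
      ≡⟨ sum-cong-≗ (λ a → *-distribʳ-sum (∂ (ends G a) v) (λ k → c k * φ k a)) ⟩
    ∑[ a < m G ] ∑[ k < r ] (c k * φ k a * ∂ (ends G a) v)
      ≡⟨ sum-cong-≗ (λ a → sum-cong-≗ (λ k → ℤₚ.*-assoc (c k) (φ k a) (∂ (ends G a) v))) ⟩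
    ∑[ a < m G ] ∑[ k < r ] (c k * (φ k a * ∂ (ends G a) v))
      ≡⟨ ∑-comm (λ a k → c k * (φ k a * ∂ (ends G a) v)) ⟩
    ∑[ k < r ] ∑[ a < m G ] (c k * (φ k a * ∂ (ends G a) v))
      ≡⟨ sum-cong-≗ (λ k → *-distribˡ-sum (c k) (λ a → φ k a * ∂ (ends G a) v)) ⟨
    ∑[ k < r ] (c k * ∑[ a < m G ] (φ k a * ∂ (ends G a) v))
      ≡⟨ ∑-zero (λ k → trans (cong (c k *_) (flows k v)) (ℤₚ.*-zeroʳ (c k))) ⟩
    0ℤ
      ∎
    where open ≡-Reasoning

  flowOrientation : (Edge G → ℤ) → Orientation G
  flowOrientation f a = positive (f a)

  nowhereZeroFlow-unit⇒StronglyConnectedWithout :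
    EdgeConnected 3 G → ∀ {f} → IsFlow f → (∀ a → f a ≢ 0ℤ) →
    ∀ e → IsUnit (f e) → StronglyConnectedWithout G (flowOrientation f) e
  nowhereZeroFlow-unit⇒StronglyConnectedWithout connected {f} flow nonzero e unit X proper
    with any? (λ a → ¬? (a ≟ e) ×-dec (X (tail G D a) Bool.≟ true) ×-dec (X (head G D a) Bool.≟ false))
    where D = flowOrientation f
  ... | yes leaving = leaving
  ... | no ¬leaving = ⊥-elim (cut-too-small (countF (crosses G X)) (connected X proper) (begin
    0ℤ                                                ≡⟨ flow-across-cut {f} flow X ⟨
    ∑[ a < m G ] (f a * χ-cut X a)                    ≤⟨ ∑-mono-≤ bound ⟩
    ∑[ a < m G ] (+ δ e a * + 2 - χ (crosses G X a))  ≡⟨ ∑-distrib-− (λ a → + δ e a * + 2) (λ a → χ (crosses G X a)) ⟩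
    ∑[ a < m G ] (+ δ e a * + 2) - ∑[ a < m G ] χ (crosses G X a)
                                                      ≡⟨ cong₂ _-_ (∑-δ e (λ _ → + 2)) (sym (+-countF (crosses G X))) ⟩
    + 2 - + countF (crosses G X)                      ∎))
    where
    open ℤₚ.≤-Reasoning
    cut-too-small : ∀ c → 3 ℕ.≤ c → ¬ (0ℤ ≤ + 2 - + c)
    cut-too-small _ (s≤s (s≤s (s≤s _))) ()
    bound : ∀ a → f a * χ-cut X a ≤ + δ e a * + 2 - χ (crosses G X a)
    bound a with e ≟ a
    ... | yes refl = unit-cut-bound unit (X (p₁ e)) (X (p₂ e))
    ... | no e≢a   = ℤₚ.≤-trans
      (entering-cut-bound (f a) (nonzero a) (X (p₁ a)) (X (p₂ a)) λ (t , h) →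
        ¬leaving (a , (λ a≡e → e≢a (sym a≡e)) , trans (if-float X (positive (f a))) t , trans (if-float X (positive (f a))) h))
      (ℤₚ.≤-reflexive (sym (ℤₚ.+-identityˡ _)))

  incid-δ : ∀ a v → incid G a v ≡ δ (p₁ a) v ℕ.+ δ (p₂ a) v
  incid-δ a v = cong₂ ℕ._+_ (cong (if_then 1 else 0) (isYes≗does (p₁ a ≟ v)))
                             (cong (if_then 1 else 0) (isYes≗does (p₂ a ≟ v)))

  degIn-complement : ∀ S v → degIn G S v ℕ.+ degIn G (λ a → not (S a)) v ≡ degree G v
  degIn-complement S v =
    trans (sym (sumF-+ (λ a → if S a then incid G a v else 0) (λ a → if not (S a) then incid G a v else 0)))
          (sumF-cong split)
    where
    split : ∀ a → (if S a then incid G a v else 0) ℕ.+ (if not (S a) then incid G a v else 0) ≡ incid G a v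
    split a with S a
    ... | true  = ℕₚ.+-identityʳ _
    ... | false = refl

  perfectMatching-complement : Cubic G → ∀ {M} → PerfectMatching G M → ∀ v → degIn G (λ a → not (M a)) v ≡ 2
  perfectMatching-complement cubic {M} perfect v =
    ℕₚ.suc-injective (trans (cong (ℕ._+ degIn G (λ a → not (M a)) v) (sym (perfect v)))
                            (trans (degIn-complement M v) (cubic v)))

  circulation : (Edge G → Bool) → Orientation G → Edge G → ℤ
  circulation S o a = if S a then ±1 (o a) else 0ℤ

  -- Edges outside S become loops: they do not change the net flow, and they keep degrees even.
  arcOrLoop : (Edge G → Bool) → Edge G → Arc {n G}
  arcOrLoop S a = if S a then ends G a else (p₁ a , p₁ a)

  circulation-∂ : ∀ S o a w → circulation S o a * ∂ (ends G a) w ≡ ±1 (o a) * ∂ (arcOrLoop S a) w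
  circulation-∂ S o a w with S a
  ... | true  = refl
  ... | false = trans (ℤₚ.*-zeroˡ (∂ (ends G a) w))
                      (sym (trans (cong (±1 (o a) *_) (ℤₚ.+-inverseʳ (+ δ (p₁ a) w))) (ℤₚ.*-zeroʳ (±1 (o a)))))

  arcOrLoop-degree : ∀ S a w → δ (proj₁ (arcOrLoop S a)) w ℕ.+ δ (proj₂ (arcOrLoop S a)) w
                               ≡ (if S a then incid G a w else 0) ℕ.+ 2 ℕ.* (if S a then 0 else δ (p₁ a) w)
  arcOrLoop-degree S a w with S a
  ... | true  = trans (sym (incid-δ a w)) (sym (ℕₚ.+-identityʳ _))
  ... | false = cong (δ (p₁ a) w ℕ.+_) (sym (ℕₚ.+-identityʳ _))

  evenSubgraph⇒circulation : ∀ S → (∀ v → ∃[ t ] degIn G S v ≡ 2 ℕ.* t) → ∃[ o ] IsFlow (circulation S o)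
  evenSubgraph⇒circulation S even with balancedOrientation (tabulate (arcOrLoop S))
  ... | ds , r , balanced = orientationOf r , λ w → begin
    ∑[ a < m G ] (circulation S o a * ∂ (ends G a) w)  ≡⟨ sum-cong-≗ (λ a → circulation-∂ S o a w) ⟩
    ∑[ a < m G ] (±1 (o a) * ∂ (arcOrLoop S a) w)      ≡⟨ ∑-orientationOf r w ⟩
    + outdeg ds w - + indeg ds w                      ≡⟨ cong (λ x → + x - + indeg ds w) (out≡in w) ⟩
    + indeg ds w - + indeg ds w                       ≡⟨ ℤₚ.+-inverseʳ (+ indeg ds w) ⟩
    0ℤ                                                ∎
    where
    open ≡-Reasoning
    o = orientationOf r
    loops : Vertex G → ℕ
    loops w = sumF (λ a → if S a then 0 else δ (p₁ a) w)
    total : ∀ w → outdeg ds w ℕ.+ indeg ds w ≡ 2 ℕ.* (proj₁ (even w) ℕ.+ loops w)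
    total w = begin
      outdeg ds w ℕ.+ indeg ds w
        ≡⟨ degree-preserved r w ⟩
      outdeg (tabulate (arcOrLoop S)) w ℕ.+ indeg (tabulate (arcOrLoop S)) w
        ≡⟨ degrees-tabulate (arcOrLoop S) w ⟩
      sumF (λ a → δ (proj₁ (arcOrLoop S a)) w ℕ.+ δ (proj₂ (arcOrLoop S a)) w)
        ≡⟨ sumF-cong (λ a → arcOrLoop-degree S a w) ⟩
      sumF (λ a → (if S a then incid G a w else 0) ℕ.+ 2 ℕ.* (if S a then 0 else δ (p₁ a) w))
        ≡⟨ sumF-+ (λ a → if S a then incid G a w else 0) (λ a → 2 ℕ.* (if S a then 0 else δ (p₁ a) w)) ⟩
      degIn G S w ℕ.+ sumF (λ a → 2 ℕ.* (if S a then 0 else δ (p₁ a) w))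
        ≡⟨ cong₂ ℕ._+_ (proj₂ (even w)) (sumF-*ˡ 2 (λ a → if S a then 0 else δ (p₁ a) w)) ⟩
      2 ℕ.* proj₁ (even w) ℕ.+ 2 ℕ.* loops w
        ≡⟨ ℕₚ.*-distribˡ-+ 2 (proj₁ (even w)) (loops w) ⟨
      2 ℕ.* (proj₁ (even w) ℕ.+ loops w)
        ∎
    out≡in : ∀ w → outdeg ds w ≡ indeg ds w
    out≡in w = AlmostEqual-even⇒≡ (proj₁ (even w) ℕ.+ loops w) (balanced w) (total w)

-- The separating coefficient matrix

allSubset? : ∀ {n} {P : Pred (Subset n) 0ℓ} → Decidable P → Dec (∀ s → P s)
allSubset? P? with anySubset? (λ s → ¬? (P? s))
... | yes (s , ¬ps) = no λ ∀p → ¬ps (∀p s)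
... | no ∄¬p        = yes λ s → decidable-stable (P? s) λ ¬ps → ∄¬p (s , ¬ps)

coefficient : Fin 5 → Fin 4 → ℤ
coefficient j k = lookup (lookup rows j) k
  where
  rows : Vec (Vec ℤ 4) 5
  rows = (+ 0 ∷ + 2      ∷ -[1+ 3 ] ∷ + 3      ∷ [])
       ∷ (+ 0 ∷ + 2      ∷ -[1+ 3 ] ∷ -[1+ 2 ] ∷ [])
       ∷ (+ 2 ∷ -[1+ 3 ] ∷ -[1+ 2 ] ∷ + 0      ∷ [])
       ∷ (+ 0 ∷ + 1      ∷ -[1+ 1 ] ∷ + 4      ∷ [])
       ∷ (+ 1 ∷ + 4      ∷ + 2      ∷ + 0      ∷ [])
       ∷ []

Separating : (Fin 5 → ℤ) → Set
Separating y = (∀ j → y j ≢ 0ℤ) × ∃[ j ] IsUnit (y j)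

-- Checked by evaluation on all 2⁸ local patterns at an edge: inM k tells whether the edge lies in
-- the k-th matching, dir k in which direction the k-th circulation traverses it.  Opaque, because
-- unfolding the certificate at symbolic arguments (e.g. during with-abstraction) is prohibitively slow.
opaque
  coefficients-separate : ∀ (inM dir : Subset 4) → countF (lookup inM) ℕ.≤ 2 →
    Separating (λ j → ∑[ k < 4 ] (coefficient j k * (if not (lookup inM k) then ±1 (lookup dir k) else 0ℤ)))
  coefficients-separate = from-yes (allSubset? λ inM → allSubset? λ dir →
    (countF (lookup inM) ℕ.≤? 2) →-dec
      separating? (λ j → ∑[ k < 4 ] (coefficient j k * (if not (lookup inM k) then ±1 (lookup dir k) else 0ℤ))))
    where
    separating? : ∀ y → Dec (Separating y)
    separating? y = all? (λ j → ¬? (y j ℤₚ.≟ 0ℤ)) ×-dec any? (λ j → (y j ℤₚ.≟ 1ℤ) ⊎-dec (y j ℤₚ.≟ -1ℤ))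

module _ (G : Graph) where

  combination : (Fin 4 → Edge G → Bool) → (Fin 4 → Orientation G) → Fin 5 → Edge G → ℤ
  combination M o j a = ∑[ k < 4 ] (coefficient j k * circulation G (λ a → not (M k a)) (o k) a)

  combination-separates : ∀ M o a → countF (λ k → M k a) ℕ.≤ 2 → Separating (λ j → combination M o j a)
  combination-separates M o a = coefficients-separate (tabulateᵥ (λ k → M k a)) (tabulateᵥ (λ k → o k a))

  frankFamily : EdgeConnected 3 G → ∀ M → (∀ a → countF (λ k → M k a) ℕ.≤ 2) →
    ∀ o → (∀ k → IsFlow G (circulation G (λ a → not (M k a)) (o k))) →
    FrankFamily G 5 (λ j → flowOrientation G (combination M o j))
  frankFamily connected M atMostTwo o flows e with combination-separates M o e (atMostTwo e)
  ... | _ , j , unit = j , nowhereZeroFlow-unit⇒StronglyConnectedWithout G connected {combination M o j}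
    (∑-flow G (coefficient j) (λ k → circulation G (λ a → not (M k a)) (o k)) flows)
    (λ a → proj₁ (combination-separates M o a (atMostTwo a)) j) e unit

theorem15 : (G : Graph) → Cubic G → EdgeConnected 3 G →
    (∃[ M ] (Injective _≡_ _≡_ M × (∀ i → PerfectMatching G (M i))
      × (∀ (e : Edge G) → countF (λ (i : Fin 6) → M i e) ≡ 2))) →
    FrankNumberAtMost G 5
theorem15 G cubic connected (M , _ , perfect , twice) =
  5 , ℕₚ.≤-refl , _ , frankFamily G connected M′ atMostTwo (λ k → proj₁ (circulations k)) (λ k → proj₂ (circulations k))
  where
  M′ : Fin 4 → Edge G → Bool
  M′ k = M (suc (suc k))
  atMostTwo : ∀ a → countF (λ k → M′ k a) ℕ.≤ 2
  atMostTwo a = subst (countF (λ k → M′ k a) ℕ.≤_) (twice a)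
    (ℕₚ.≤-trans (ℕₚ.m≤n+m (countF (λ k → M′ k a)) (if M (suc zero) a then 1 else 0))
                (ℕₚ.m≤n+m _ (if M zero a then 1 else 0)))
  circulations : ∀ k → ∃[ o ] IsFlow G (circulation G (λ a → not (M′ k a)) o)
  circulations k = evenSubgraph⇒circulation G (λ a → not (M′ k a))
                     (λ v → 1 , perfectMatching-complement G cubic (perfect (suc (suc k))) v)
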